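{- Let $G$ be a graph with no isolated vertices and nonnegative weights $w_v\leq w_e$. Let $S_{wmd}$ be a minimum-weight mixed dominating set and $S_{vc}$ a minimum vertex cover of $G$. Then for every mixed dominating set $D$ and every vertex cover $C$ of $G$, $w(S_{wmd})\leq w(C)$ and $w(S_{vc})\leq 2w(D)$.
   Context: In a graph $G=(V,E)$, a vertex dominates itself, all its neighbours and all edges incident to it; an edge dominates itself, its two endpoints and all edges sharing an endpoint with it. A mixed dominating set is a set $D\subseteq V\cup E$ such that every vertex and every edge is dominated by at least one element of $D$. For any set $X\subseteq V\cup E$, $w(X)=w_v|X\cap V|+w_e|X\cap E|$. A vertex cover is a set of vertices containing at least one endpoint of every edge.
   Formalization: The weights $w_v$ and $w_e$ are taken to be nonnegative rationals. -}

module Defs where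

open import Data.Nat using (ℕ)
open import Data.Fin using (Fin)
open import Data.Fin.Subset using (Subset; _∈_; ∣_∣)
open import Data.Product using (_×_; _,_; proj₁; proj₂; ∃; Σ)
open import Data.Sum using (_⊎_)
open import Relation.Binary.PropositionalEquality using (_≡_; _≢_)
open import Data.Rational using (ℚ; _+_; _*_; _≤_; 0ℚ)
import Data.Rational as ℚ
import Data.Integer as ℤ

record Graph : Set where
  field
    n m   : ℕ
    ends  : Fin m → Fin n × Fin n
    loopless : ∀ e → proj₁ (ends e) ≢ proj₂ (ends e)
    simple   : ∀ e f → (proj₁ (ends e) ≡ proj₁ (ends f) × proj₂ (ends e) ≡ proj₂ (ends f)
                        ⊎ proj₁ (ends e) ≡ proj₂ (ends f) × proj₂ (ends e) ≡ proj₁ (ends f))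
                      → e ≡ f

module _ (G : Graph) where
  open Graph G

  IncidentTo : Fin n → Fin m → Set
  IncidentTo v e = v ≡ proj₁ (ends e) ⊎ v ≡ proj₂ (ends e)

  Adjacent : Fin n → Fin n → Set
  Adjacent u v = ∃ λ e → (u ≡ proj₁ (ends e) × v ≡ proj₂ (ends e))
                        ⊎ (u ≡ proj₂ (ends e) × v ≡ proj₁ (ends e))

  ShareEndpoint : Fin m → Fin m → Set
  ShareEndpoint e f = ∃ λ v → IncidentTo v e × IncidentTo v f

  NoIsolatedVertices : Set
  NoIsolatedVertices = ∀ v → ∃ λ e → IncidentTo v e

  MixedSet : Set
  MixedSet = Subset n × Subset m

  VertexDominated : MixedSet → Fin n → Set
  VertexDominated (DV , DE) x =
    x ∈ DV ⊎ (∃ λ u → u ∈ DV × Adjacent u x) ⊎ (∃ λ e → e ∈ DE × IncidentTo x e)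

  EdgeDominated : MixedSet → Fin m → Set
  EdgeDominated (DV , DE) f =
    (∃ λ u → u ∈ DV × IncidentTo u f) ⊎ f ∈ DE ⊎ (∃ λ e → e ∈ DE × ShareEndpoint e f)

  IsMixedDominatingSet : MixedSet → Set
  IsMixedDominatingSet D = (∀ x → VertexDominated D x) × (∀ f → EdgeDominated D f)

  IsVertexCover : Subset n → Set
  IsVertexCover C = ∀ e → ∃ λ v → v ∈ C × IncidentTo v e

  weight : ℚ → ℚ → MixedSet → ℚ
  weight wv we (DV , DE) = wv * (ℤ.+ ∣ DV ∣ ℚ./ 1) + we * (ℤ.+ ∣ DE ∣ ℚ./ 1)

  asMixed : Subset n → MixedSet
  asMixed C = C , Data.Fin.Subset.⊥

  IsMinWeightMDS : ℚ → ℚ → MixedSet → Set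
  IsMinWeightMDS wv we S = IsMixedDominatingSet S ×
    (∀ D → IsMixedDominatingSet D → weight wv we S ≤ weight wv we D)

  IsMinVertexCover : Subset n → Set
  IsMinVertexCover S = IsVertexCover S × (∀ C → IsVertexCover C → ∣ S ∣ Data.Nat.≤ ∣ C ∣)

module Submission where

-- (1) When G has no isolated vertices, every vertex cover C is itself a
--     mixed dominating set (each edge has an endpoint in C; each vertex x
--     lies on some edge, whose covering endpoint is x or a neighbour of x).
--     Hence w(S_wmd) ≤ w(C) by minimality of S_wmd.
-- (2) Conversely, from a mixed dominating set D = (DV , DE) we obtain the
--     vertex cover DV ∪ ends(DE), where ends(DE) is the set of endpoints of
--     the edges in DE: an edge dominated by a vertex, by itself, or by a
--     neighbouring edge always has an endpoint in this set.  It has at most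
--     |DV| + 2|DE| vertices, so |S_vc| ≤ |DV| + 2|DE|, and the weight
--     inequality w_v |S_vc| ≤ 2 (w_v |DV| + w_e |DE|) follows from
--     0 ≤ w_v ≤ w_e.

open import Defs
open import Data.Product using (_×_)
open import Data.Fin.Subset using (Subset)
open import Data.Rational using (ℚ; _≤_; _*_; 0ℚ; 1ℚ; _+_)

open import Data.Nat as ℕ using (ℕ)
import Data.Nat.Properties as ℕP
import Data.Integer as ℤ
import Data.Integer.Properties as ℤP
open import Data.Rational using (mkℚ; _/_; *≤*; nonNegative)
open import Data.Rational.Properties
open import Data.Rational.Solver using (module +-*-Solver)
open import Data.Nat.Coprimality using (1-coprimeTo; sym)
open import Relation.Binary.PropositionalEquality as Eq using (_≡_; refl; cong; cong₂)
open import Data.Product using (_,_; proj₁; proj₂)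
open import Data.Sum using (inj₁; inj₂)
open import Data.Fin using (Fin; zero; suc)
open import Data.Vec using ([]; _∷_; here; there)
open import Data.Fin.Subset using (inside; outside; _∈_; _∪_; ⁅_⁆; ∣_∣)
import Data.Fin.Subset as Subset
open import Data.Fin.Subset.Properties using (p⊆p∪q; q⊆p∪q; x∈⁅x⁆; ∣⁅x⁆∣≡1; ∣⊥∣≡0)
open import Function using (_∘_)

toℚ : ℕ → ℚ
toℚ k = ℤ.+ k / 1

toℚ-normal : ∀ k → toℚ k ≡ mkℚ (ℤ.+ k) 0 (sym (1-coprimeTo k))
toℚ-normal k = normalize-coprime (sym (1-coprimeTo k))

toℚ-homo-+ : ∀ a b → toℚ (a ℕ.+ b) ≡ toℚ a + toℚ b
toℚ-homo-+ a b = Eq.sym sum-of-embeddings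
  where
  sum-of-embeddings : toℚ a + toℚ b ≡ toℚ (a ℕ.+ b)
  sum-of-embeddings rewrite toℚ-normal a | toℚ-normal b =
    cong (_/ 1) (cong₂ ℤ._+_ (ℤP.*-identityʳ (ℤ.+ a)) (ℤP.*-identityʳ (ℤ.+ b)))

toℚ-mono-≤ : ∀ {a b} → a ℕ.≤ b → toℚ a ≤ toℚ b
toℚ-mono-≤ {a} {b} a≤b rewrite toℚ-normal a | toℚ-normal b =
  *≤* (Eq.subst₂ ℤ._≤_ (Eq.sym (ℤP.*-identityʳ (ℤ.+ a))) (Eq.sym (ℤP.*-identityʳ (ℤ.+ b)))
                 (ℤ.+≤+ a≤b))

toℚ-nonNeg : ∀ a → 0ℚ ≤ toℚ a
toℚ-nonNeg a = toℚ-mono-≤ (ℕ.z≤n {a})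

∣p∪q∣≤∣p∣+∣q∣ : ∀ {n} (p q : Subset n) → ∣ p ∪ q ∣ ℕ.≤ ∣ p ∣ ℕ.+ ∣ q ∣
∣p∪q∣≤∣p∣+∣q∣ [] [] = ℕ.z≤n
∣p∪q∣≤∣p∣+∣q∣ (outside ∷ p) (outside ∷ q) = ∣p∪q∣≤∣p∣+∣q∣ p q
∣p∪q∣≤∣p∣+∣q∣ (outside ∷ p) (inside ∷ q) rewrite ℕP.+-suc ∣ p ∣ ∣ q ∣ = ℕ.s≤s (∣p∪q∣≤∣p∣+∣q∣ p q)
∣p∪q∣≤∣p∣+∣q∣ (inside ∷ p) (outside ∷ q) = ℕ.s≤s (∣p∪q∣≤∣p∣+∣q∣ p q)
∣p∪q∣≤∣p∣+∣q∣ (inside ∷ p) (inside ∷ q) =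
  ℕ.s≤s (ℕP.≤-trans (∣p∪q∣≤∣p∣+∣q∣ p q) (ℕP.+-monoʳ-≤ ∣ p ∣ (ℕP.n≤1+n ∣ q ∣)))

module _ {n : ℕ} where

  endpoints : ∀ {k} → Subset k → (Fin k → Fin n × Fin n) → Subset n
  endpoints [] ends = Subset.⊥
  endpoints (outside ∷ E) ends = endpoints E (ends ∘ suc)
  endpoints (inside ∷ E) ends =
    (⁅ proj₁ (ends zero) ⁆ ∪ ⁅ proj₂ (ends zero) ⁆) ∪ endpoints E (ends ∘ suc)

  ∣endpoints∣≤2∣E∣ : ∀ {k} (E : Subset k) ends → ∣ endpoints E ends ∣ ℕ.≤ ∣ E ∣ ℕ.+ ∣ E ∣
  ∣endpoints∣≤2∣E∣ [] ends = ℕP.≤-reflexive (∣⊥∣≡0 n)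
  ∣endpoints∣≤2∣E∣ (outside ∷ E) ends = ∣endpoints∣≤2∣E∣ E (ends ∘ suc)
  ∣endpoints∣≤2∣E∣ (inside ∷ E) ends = begin
      ∣ pair ∪ rest ∣                 ≤⟨ ∣p∪q∣≤∣p∣+∣q∣ pair rest ⟩
      ∣ pair ∣ ℕ.+ ∣ rest ∣           ≤⟨ ℕP.+-mono-≤ ∣pair∣≤2 (∣endpoints∣≤2∣E∣ E (ends ∘ suc)) ⟩
      2 ℕ.+ (∣ E ∣ ℕ.+ ∣ E ∣)          ≡⟨ cong ℕ.suc (ℕP.+-suc ∣ E ∣ ∣ E ∣) ⟨
      ℕ.suc ∣ E ∣ ℕ.+ ℕ.suc ∣ E ∣      ∎
    where
    open ℕP.≤-Reasoning
    pair = ⁅ proj₁ (ends zero) ⁆ ∪ ⁅ proj₂ (ends zero) ⁆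
    rest = endpoints E (ends ∘ suc)
    ∣pair∣≤2 : ∣ pair ∣ ℕ.≤ 2
    ∣pair∣≤2 = ℕP.≤-trans (∣p∪q∣≤∣p∣+∣q∣ ⁅ proj₁ (ends zero) ⁆ ⁅ proj₂ (ends zero) ⁆)
                 (ℕP.≤-reflexive (cong₂ ℕ._+_ (∣⁅x⁆∣≡1 (proj₁ (ends zero))) (∣⁅x⁆∣≡1 (proj₂ (ends zero)))))

  first∈endpoints : ∀ {k} (E : Subset k) ends {e} → e ∈ E → proj₁ (ends e) ∈ endpoints E ends
  first∈endpoints (inside ∷ E) ends here = p⊆p∪q _ (p⊆p∪q _ (x∈⁅x⁆ _))
  first∈endpoints (outside ∷ E) ends (there e∈E) = first∈endpoints E (ends ∘ suc) e∈E
  first∈endpoints (inside ∷ E) ends (there e∈E) = q⊆p∪q _ _ (first∈endpoints E (ends ∘ suc) e∈E)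

  second∈endpoints : ∀ {k} (E : Subset k) ends {e} → e ∈ E → proj₂ (ends e) ∈ endpoints E ends
  second∈endpoints (inside ∷ E) ends here = p⊆p∪q _ (q⊆p∪q _ _ (x∈⁅x⁆ _))
  second∈endpoints (outside ∷ E) ends (there e∈E) = second∈endpoints E (ends ∘ suc) e∈E
  second∈endpoints (inside ∷ E) ends (there e∈E) = q⊆p∪q _ _ (second∈endpoints E (ends ∘ suc) e∈E)

module _ (G : Graph) where
  open Graph G

  incident∈endpoints : ∀ (E : Subset m) {e v} → e ∈ E → IncidentTo G v e → v ∈ endpoints E ends
  incident∈endpoints E e∈E (inj₁ refl) = first∈endpoints E ends e∈E
  incident∈endpoints E e∈E (inj₂ refl) = second∈endpoints E ends e∈E

  cover⇒mixedDominating : NoIsolatedVertices G → ∀ C → IsVertexCover G C →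
                          IsMixedDominatingSet G (asMixed G C)
  cover⇒mixedDominating noIsolated C cover = vertexDominated , λ f → inj₁ (cover f)
    where
    -- x lies on an edge e; the endpoint v of e in C is x itself or its neighbour.
    vertexDominated : ∀ x → VertexDominated G (asMixed G C) x
    vertexDominated x with noIsolated x
    ... | e , x-on-e with cover e
    ... | v , v∈C , v-on-e with x-on-e | v-on-e
    ... | inj₁ refl | inj₁ refl = inj₁ v∈C
    ... | inj₂ refl | inj₂ refl = inj₁ v∈C
    ... | inj₁ refl | inj₂ refl = inj₂ (inj₁ (v , v∈C , e , inj₂ (refl , refl)))
    ... | inj₂ refl | inj₁ refl = inj₂ (inj₁ (v , v∈C , e , inj₁ (refl , refl)))

  mixedDominating⇒cover : ∀ DV DE → IsMixedDominatingSet G (DV , DE) →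
                          IsVertexCover G (DV ∪ endpoints DE ends)
  mixedDominating⇒cover DV DE (_ , edgeDominated) f with edgeDominated f
  ... | inj₁ (u , u∈DV , u-on-f) = u , p⊆p∪q _ u∈DV , u-on-f
  ... | inj₂ (inj₁ f∈DE) = proj₁ (ends f) , q⊆p∪q DV _ (first∈endpoints DE ends f∈DE) , inj₁ refl
  ... | inj₂ (inj₂ (e , e∈DE , v , v-on-e , v-on-f)) =
    v , q⊆p∪q DV _ (incident∈endpoints DE e∈DE v-on-e) , v-on-f

  ∣minCover∣≤ : ∀ S → IsMinVertexCover G S → ∀ DV DE → IsMixedDominatingSet G (DV , DE) →
                ∣ S ∣ ℕ.≤ ∣ DV ∣ ℕ.+ ∣ DE ∣ ℕ.+ ∣ DE ∣
  ∣minCover∣≤ S (_ , minimal) DV DE mds = begin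
    ∣ S ∣                             ≤⟨ minimal _ (mixedDominating⇒cover DV DE mds) ⟩
    ∣ DV ∪ endpoints DE ends ∣        ≤⟨ ∣p∪q∣≤∣p∣+∣q∣ DV (endpoints DE ends) ⟩
    ∣ DV ∣ ℕ.+ ∣ endpoints DE ends ∣      ≤⟨ ℕP.+-monoʳ-≤ ∣ DV ∣ (∣endpoints∣≤2∣E∣ DE ends) ⟩
    ∣ DV ∣ ℕ.+ (∣ DE ∣ ℕ.+ ∣ DE ∣)        ≡⟨ ℕP.+-assoc (∣ DV ∣) (∣ DE ∣) (∣ DE ∣) ⟨
    ∣ DV ∣ ℕ.+ ∣ DE ∣ ℕ.+ ∣ DE ∣          ∎
    where open ℕP.≤-Reasoning

  weight-asMixed : ∀ wv we C → weight G wv we (asMixed G C) ≡ wv * toℚ ∣ C ∣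
  weight-asMixed wv we C rewrite ∣⊥∣≡0 m =
    Eq.trans (cong (wv * toℚ ∣ C ∣ +_) (*-zeroʳ we)) (+-identityʳ (wv * toℚ ∣ C ∣))

weighted-≤-double : (w e A B X : ℚ) → 0ℚ ≤ w → w ≤ e → 0ℚ ≤ A → 0ℚ ≤ B →
                    X ≤ A + B + B → w * X ≤ (1ℚ + 1ℚ) * (w * A + e * B)
weighted-≤-double w e A B X 0≤w w≤e 0≤A 0≤B X≤A+2B = begin
    w * X                              ≤⟨ *-monoˡ-≤-nonNeg w {{nonNegative 0≤w}} X≤A+2B ⟩
    w * (A + B + B)                    ≡⟨ expand ⟩
    w * A + (w * B + w * B)            ≤⟨ +-mono-≤ wA≤2wA (+-mono-≤ wB≤eB wB≤eB) ⟩
    (w * A + w * A) + (e * B + e * B)  ≡⟨ collect ⟩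
    (1ℚ + 1ℚ) * (w * A + e * B)        ∎
  where
  open ≤-Reasoning
  open +-*-Solver
  expand : w * (A + B + B) ≡ w * A + (w * B + w * B)
  expand = solve 3 (λ w A B → w :* (A :+ B :+ B) := w :* A :+ (w :* B :+ w :* B)) refl w A B
  collect : (w * A + w * A) + (e * B + e * B) ≡ (1ℚ + 1ℚ) * (w * A + e * B)
  collect = solve 4 (λ w A e B → (w :* A :+ w :* A) :+ (e :* B :+ e :* B)
                                 := (con 1ℚ :+ con 1ℚ) :* (w :* A :+ e :* B)) refl w A e B
  0≤wA : 0ℚ ≤ w * A
  0≤wA = Eq.subst (_≤ w * A) (*-zeroʳ w) (*-monoˡ-≤-nonNeg w {{nonNegative 0≤w}} 0≤A)
  wA≤2wA : w * A ≤ w * A + w * A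
  wA≤2wA = Eq.subst (_≤ w * A + w * A) (+-identityʳ (w * A)) (+-monoʳ-≤ (w * A) 0≤wA)
  wB≤eB : w * B ≤ e * B
  wB≤eB = *-monoʳ-≤-nonNeg B {{nonNegative 0≤B}} w≤e

lemma4 : (G : Graph) → NoIsolatedVertices G →
    (wv we : ℚ) → 0ℚ ≤ wv → wv ≤ we →
    (Swmd : MixedSet G) → IsMinWeightMDS G wv we Swmd →
    (Svc : Subset (Graph.n G)) → IsMinVertexCover G Svc →
    (∀ D → IsMixedDominatingSet G D → ∀ C → IsVertexCover G C →
    (weight G wv we Swmd ≤ weight G wv we (asMixed G C))
    × (weight G wv we (asMixed G Svc) ≤ (1ℚ + 1ℚ) * weight G wv we D))
lemma4 G noIsolated wv we 0≤wv wv≤we Swmd (_ , Swmd-minimal) Svc Svc-min (DV , DE) mds C cover =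
  Swmd-minimal (asMixed G C) (cover⇒mixedDominating G noIsolated C cover) , coverBound
  where
  ∣Svc∣-bound : toℚ ∣ Svc ∣ ≤ toℚ ∣ DV ∣ + toℚ ∣ DE ∣ + toℚ ∣ DE ∣
  ∣Svc∣-bound = Eq.subst (toℚ ∣ Svc ∣ ≤_)
    (Eq.trans (toℚ-homo-+ (∣ DV ∣ ℕ.+ ∣ DE ∣) ∣ DE ∣) (cong (_+ toℚ ∣ DE ∣) (toℚ-homo-+ ∣ DV ∣ ∣ DE ∣)))
    (toℚ-mono-≤ (∣minCover∣≤ G Svc Svc-min DV DE mds))

  coverBound : weight G wv we (asMixed G Svc) ≤ (1ℚ + 1ℚ) * weight G wv we (DV , DE)
  coverBound rewrite weight-asMixed G wv we Svc =
    weighted-≤-double wv we (toℚ ∣ DV ∣) (toℚ ∣ DE ∣) (toℚ ∣ Svc ∣)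
                      0≤wv wv≤we (toℚ-nonNeg ∣ DV ∣) (toℚ-nonNeg ∣ DE ∣) ∣Svc∣-bound
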